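{- Let $n\ge2$ and let $\mathbf{Z}_n$ be the graph on vertices $0,1,\dots,n$ with a double edge from the longer vertex $1$ to the shorter vertex $0$, simple edges $1-2,\dots,(n-2)-(n-1)$, and a double edge from the longer vertex $n-1$ to the shorter vertex $n$. Let $k=\lceil (n-1)/2\rceil$. Then a set of minimal representatives of the classes is: the labeling with a single $1$ at vertex $0$; the labeling with a single $1$ at vertex $n$; the labeling with ones exactly at $0$ and $n$; and, for $i=0,\dots,k$, the labeling with $b_0=b_n=0$ and ones exactly at vertices $1,3,\dots,2i-1$. The number of classes is $\#\mathrm{Cl}(\mathbf{Z}_n)=3+(1+k)=k+4$.
   Context: Generalized Reeder's puzzle: a labeling assigns $b_j\in\mathbb{Z}/2\mathbb{Z}$ to each vertex $j$. Double edges are directed from a longer to a shorter vertex. The move $T_i$ replaces $b_i$ by $b_i+\sum_k b_k\pmod 2$, where $k$ runs over neighbors of $i$ excluding any neighbor that is the shorter endpoint of a double edge at $i$; other labels unchanged. Equivalence is generated by moves; $\mathrm{Cl}(D)$ is the set of classes; a minimal representative is a labeling in its class with the fewest $1$'s. -}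

module Defs where

open import Data.Nat using (ℕ; zero; suc; _+_; _*_; _∸_; _≡ᵇ_; _<ᵇ_; _%_; ⌈_/2⌉)
open import Data.Bool using (Bool; true; false; _∧_; _∨_; not; _xor_; if_then_else_)
open import Data.Fin using (Fin; toℕ; _≟_)
import Data.Fin as Fin
open import Data.Product using (∃)
open import Relation.Nullary.Decidable using (⌊_⌋)
open import Relation.Binary.PropositionalEquality using (_≡_)
open import Relation.Binary.Construct.Closure.Equivalence using (EqClosure)

-- A graph for the (generalized) Reeder puzzle on vertex set Fin m.
--   adjacent i k  : i and k are joined by an edge (simple or double)
--   shorterAt i k : {i,k} is a double edge and k is its shorter endpoint
record PuzzleGraph (m : ℕ) : Set where
  field
    adjacent  : Fin m → Fin m → Bool
    shorterAt : Fin m → Fin m → Bool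
open PuzzleGraph public

-- labelings b : vertices → Z/2Z (Bool with xor as addition)
Labeling : ℕ → Set
Labeling m = Fin m → Bool

xorSum : ∀ {m} → (Fin m → Bool) → Bool
xorSum {zero}  f = false
xorSum {suc m} f = f Fin.zero xor xorSum (λ k → f (Fin.suc k))

move : ∀ {m} → PuzzleGraph m → Fin m → Labeling m → Labeling m
move G i b j =
  if ⌊ j ≟ i ⌋
  then b i xor xorSum (λ k → adjacent G i k ∧ not (shorterAt G i k) ∧ b k)
  else b j

Step : ∀ {m} → PuzzleGraph m → Labeling m → Labeling m → Set
Step G b c = ∃ λ i → ∀ j → c j ≡ move G i b j

Equiv : ∀ {m} → PuzzleGraph m → Labeling m → Labeling m → Set
Equiv G = EqClosure (Step G)

weight : ∀ {m} → Labeling m → ℕ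
weight {zero}  b = 0
weight {suc m} b = (if b Fin.zero then 1 else 0) + weight (λ k → b (Fin.suc k))

Z : (n : ℕ) → PuzzleGraph (suc n)
Z n = record
  { adjacent  = λ i k → ((toℕ i + 1) ≡ᵇ toℕ k) ∨ ((toℕ k + 1) ≡ᵇ toℕ i)
  ; shorterAt = λ i k → ((toℕ i ≡ᵇ 1) ∧ (toℕ k ≡ᵇ 0))
                        ∨ ((toℕ i ≡ᵇ (n ∸ 1)) ∧ (toℕ k ≡ᵇ n))
  }

K : ℕ → ℕ
K n = ⌈ (n ∸ 1) /2⌉

data RepIx (k : ℕ) : Set where
  single0 : RepIx k
  singleN : RepIx k
  both    : RepIx k
  odds    : Fin (suc k) → RepIx k

rep : (n : ℕ) → RepIx (K n) → Labeling (suc n)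
rep n single0  j = toℕ j ≡ᵇ 0
rep n singleN  j = toℕ j ≡ᵇ n
rep n both     j = (toℕ j ≡ᵇ 0) ∨ (toℕ j ≡ᵇ n)
rep n (odds i) j = (not (toℕ j ≡ᵇ 0)) ∧ (not (toℕ j ≡ᵇ n))
                   ∧ ((toℕ j % 2) ≡ᵇ 1) ∧ (toℕ j <ᵇ (2 * toℕ i))

-- Let x be the labeling of the interior vertices 1, …, n-1, extended by x₀ = xₙ = 0, and let
-- sⱼ = xⱼ + xⱼ₊₁ (j < n) be its jump sequence. A move at an interior vertex either changes nothing
-- or swaps two adjacent jumps, while the moves at 0 and n add s₀ resp. sₙ₋₁ to the boundary labels.
-- So the number c of jumps, which is even, is invariant, and so are b₀ and bₙ when c = 0.
-- Conversely adjacent swaps sort the jumps into 1…10…0; if c > 0 the jumps can first be moved to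
-- either end to clear b₀ and bₙ, which leaves ones exactly at 1, 3, …, c-1. Minimality holds since
-- c is at most twice the number of interior ones, and b₀, bₙ are fixed when c = 0.

module Submission where

open import Defs
open import Data.Bool using (Bool; true; false; not; _∧_; _∨_; _xor_; if_then_else_; T)
open import Data.Bool.Properties
  using (∧-zeroʳ; ∧-identityʳ; ∧-idem; xor-identityʳ; xor-same; xor-assoc; xor-comm; not-distribˡ-xor)
open import Data.Bool.Solver using (module xor-∧-Solver)
open import Data.Fin as Fin using (Fin; toℕ; fromℕ<; cast)
open import Data.Fin.Properties using (toℕ-injective; toℕ<n; toℕ-fromℕ<; cast-involutive)
open import Data.List using (List; []; _∷_; _++_; length; replicate; applyUpTo)
open import Data.List.Properties using (length-++; length-replicate; length-applyUpTo; ++-identityʳ)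
open import Data.Nat
  using (ℕ; zero; suc; _+_; _*_; _∸_; _≤_; _<_; _≮_; z≤n; s≤s; z<s; s<s; _≡ᵇ_; _<ᵇ_; _%_; ⌊_/2⌋; ⌈_/2⌉; _<?_; _≟_)
open import Data.Nat.Properties
open import Data.Product using (Σ; ∃; _×_; _,_; proj₁; proj₂)
open import Function using () renaming (_∘′_ to _∘_)
import Algebra.Properties.CommutativeSemigroup +-commutativeSemigroup as +-CS
import Relation.Binary.Construct.Closure.Equivalence as Closure
open import Relation.Binary.Construct.Closure.ReflexiveTransitive as Star using (Star; ε; _◅_; _◅◅_; reverse)
open import Relation.Binary.Construct.Closure.Symmetric using (fwd; bwd)
open import Relation.Binary.PropositionalEquality
import Relation.Binary.Reasoning.Setoid as SetoidReasoning
open import Relation.Nullary using (¬_; yes; no; contradiction)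
open import Relation.Nullary.Decidable using (⌊_⌋)

T⇒≡true : ∀ {x} → T x → x ≡ true
T⇒≡true {true} _ = refl

≡true⇒T : ∀ {x} → x ≡ true → T x
≡true⇒T refl = _

¬T⇒≡false : ∀ {x} → ¬ T x → x ≡ false
¬T⇒≡false {false} _ = refl
¬T⇒≡false {true} ¬t = contradiction _ ¬t

T-∧-elimʳ : ∀ a {b} → T (a ∧ b) → T b
T-∧-elimʳ true t = t

≡ᵇ-refl : ∀ m → (m ≡ᵇ m) ≡ true
≡ᵇ-refl m = T⇒≡true (≡⇒≡ᵇ m m refl)

≡ᵇ-true⇒≡ : ∀ {m n} → (m ≡ᵇ n) ≡ true → m ≡ n
≡ᵇ-true⇒≡ {m} {n} e = ≡ᵇ⇒≡ m n (≡true⇒T e)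

≢⇒≡ᵇ-false : ∀ {m n} → m ≢ n → (m ≡ᵇ n) ≡ false
≢⇒≡ᵇ-false {m} {n} m≢n = ¬T⇒≡false (m≢n ∘ ≡ᵇ⇒≡ m n)

<⇒<ᵇ-true : ∀ {m n} → m < n → (m <ᵇ n) ≡ true
<⇒<ᵇ-true m<n = T⇒≡true (<⇒<ᵇ m<n)

≮⇒<ᵇ-false : ∀ {m n} → m ≮ n → (m <ᵇ n) ≡ false
≮⇒<ᵇ-false {m} {n} m≮n = ¬T⇒≡false (m≮n ∘ <ᵇ⇒< m n)

≤⇒not-≡ᵇ≡<ᵇ : ∀ {m n} → m ≤ n → not (m ≡ᵇ n) ≡ (m <ᵇ n)
≤⇒not-≡ᵇ≡<ᵇ {n = zero}  z≤n = refl
≤⇒not-≡ᵇ≡<ᵇ {n = suc n} z≤n = refl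
≤⇒not-≡ᵇ≡<ᵇ (s≤s m≤n) = ≤⇒not-≡ᵇ≡<ᵇ m≤n

isOdd : ℕ → Bool
isOdd q = (q % 2) ≡ᵇ 1

isOdd-suc : ∀ q → isOdd (suc q) ≡ not (isOdd q)
isOdd-suc zero = refl
isOdd-suc (suc zero) = refl
isOdd-suc (suc (suc q)) = isOdd-suc q

isOdd-2* : ∀ i → isOdd (2 * i) ≡ false
isOdd-2* zero = refl
isOdd-2* (suc i) = subst (λ c → isOdd c ≡ false) (sym (*-suc 2 i)) (isOdd-2* i)

even⇒2* : ∀ c → isOdd c ≡ false → ∃ λ i → c ≡ 2 * i
even⇒2* zero _ = 0 , refl
even⇒2* (suc (suc c)) ev with even⇒2* c ev
... | i , refl = suc i , sym (*-suc 2 i)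

2*≤⇒≤⌊/2⌋ : ∀ i n → 2 * i ≤ n → i ≤ ⌊ n /2⌋
2*≤⇒≤⌊/2⌋ i n 2i≤n = subst (_≤ ⌊ n /2⌋) ⌊2*i/2⌋≡i (⌊n/2⌋-mono 2i≤n)
  where
  ⌊2*i/2⌋≡i : ⌊ 2 * i /2⌋ ≡ i
  ⌊2*i/2⌋≡i = sym (trans (n≡⌊n+n/2⌋ i) (cong (λ j → ⌊ i + j /2⌋) (sym (+-identityʳ i))))

xor-interchange : ∀ a b c d → (a xor b) xor (c xor d) ≡ (a xor c) xor (b xor d)
xor-interchange = solve 4 (λ a b c d → (a :+ b) :+ (c :+ d) := (a :+ c) :+ (b :+ d)) refl
  where open xor-∧-Solver

xor-left-comm : ∀ a b c → a xor (b xor c) ≡ b xor (a xor c)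
xor-left-comm = solve 3 (λ a b c → a :+ (b :+ c) := b :+ (a :+ c)) refl
  where open xor-∧-Solver

xor-cancelˡ : ∀ a b → a xor (a xor b) ≡ b
xor-cancelˡ = solve 2 (λ a b → a :+ (a :+ b) := b) refl
  where open xor-∧-Solver

xor-cancel-middle : ∀ a b c → (a xor b) xor (b xor c) ≡ a xor c
xor-cancel-middle = solve 3 (λ a b c → (a :+ b) :+ (b :+ c) := a :+ c) refl
  where open xor-∧-Solver

bit : Bool → ℕ
bit b = if b then 1 else 0

bit-xor-≤ : ∀ a b → bit (a xor b) ≤ bit a + bit b
bit-xor-≤ true  true  = z≤n
bit-xor-≤ true  false = ≤-refl
bit-xor-≤ false b     = ≤-refl

bit-mono : ∀ {a b} → (T a → T b) → bit a ≤ bit b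
bit-mono {false} _ = z≤n
bit-mono {true} a⇒b with T⇒≡true (a⇒b _)
... | refl = ≤-refl

xorBelow : ℕ → (ℕ → Bool) → Bool
xorBelow zero    F = false
xorBelow (suc m) F = F 0 xor xorBelow m (F ∘ suc)

countBelow : ℕ → (ℕ → Bool) → ℕ
countBelow zero    F = 0
countBelow (suc m) F = bit (F 0) + countBelow m (F ∘ suc)

xorBelow-cong : ∀ m {F G} → (∀ {q} → q < m → F q ≡ G q) → xorBelow m F ≡ xorBelow m G
xorBelow-cong zero    F≗G = refl
xorBelow-cong (suc m) F≗G = cong₂ _xor_ (F≗G z<s) (xorBelow-cong m (F≗G ∘ s<s))

xorBelow-false : ∀ m → xorBelow m (λ _ → false) ≡ false
xorBelow-false zero    = refl
xorBelow-false (suc m) = xorBelow-false m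

xorBelow-xor : ∀ m F G → xorBelow m (λ q → F q xor G q) ≡ xorBelow m F xor xorBelow m G
xorBelow-xor zero    F G = refl
xorBelow-xor (suc m) F G =
  trans (cong ((F 0 xor G 0) xor_) (xorBelow-xor m (F ∘ suc) (G ∘ suc))) (xor-interchange (F 0) (G 0) _ _)

xorBelow-suc : ∀ m F → xorBelow (suc m) F ≡ xorBelow m F xor F m
xorBelow-suc zero    F = xor-identityʳ (F 0)
xorBelow-suc (suc m) F =
  trans (cong (F 0 xor_) (xorBelow-suc m (F ∘ suc))) (sym (xor-assoc (F 0) _ (F (suc m))))

xorBelow-telescope : ∀ m G → xorBelow m (λ q → G q xor G (suc q)) ≡ G 0 xor G m
xorBelow-telescope zero    G = sym (xor-same (G 0))
xorBelow-telescope (suc m) G =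
  trans (cong ((G 0 xor G 1) xor_) (xorBelow-telescope m (G ∘ suc))) (xor-cancel-middle (G 0) (G 1) (G (suc m)))

xorBelow-pointˡ : ∀ m a G → xorBelow m (λ q → (a ≡ᵇ q) ∧ G q) ≡ (a <ᵇ m) ∧ G a
xorBelow-pointˡ zero    a       G = refl
xorBelow-pointˡ (suc m) zero    G = trans (cong (G 0 xor_) (xorBelow-false m)) (xor-identityʳ (G 0))
xorBelow-pointˡ (suc m) (suc a) G = xorBelow-pointˡ m a (G ∘ suc)

xorBelow-pointʳ : ∀ m a G → xorBelow m (λ q → (q ≡ᵇ a) ∧ G q) ≡ (a <ᵇ m) ∧ G a
xorBelow-pointʳ zero    a       G = refl
xorBelow-pointʳ (suc m) zero    G = trans (cong (G 0 xor_) (xorBelow-false m)) (xor-identityʳ (G 0))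
xorBelow-pointʳ (suc m) (suc a) G = xorBelow-pointʳ m a (G ∘ suc)

countBelow-cong : ∀ m {F G} → (∀ {q} → q < m → F q ≡ G q) → countBelow m F ≡ countBelow m G
countBelow-cong zero    F≗G = refl
countBelow-cong (suc m) F≗G = cong₂ (λ x y → bit x + y) (F≗G z<s) (countBelow-cong m (F≗G ∘ s<s))

countBelow-false : ∀ m → countBelow m (λ _ → false) ≡ 0
countBelow-false zero    = refl
countBelow-false (suc m) = countBelow-false m

countBelow-point : ∀ m a → a < m → countBelow m (λ q → q ≡ᵇ a) ≡ 1
countBelow-point (suc m) zero    _         = cong suc (countBelow-false m)
countBelow-point (suc m) (suc a) (s<s a<m) = countBelow-point m a a<m

countBelow-≡0 : ∀ m F → countBelow m F ≡ 0 → ∀ {q} → q < m → F q ≡ false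
countBelow-≡0 (suc m) F c≡0 {q} q<m with F 0 in F0
countBelow-≡0 (suc m) F c≡0 {zero}  _         | false = F0
countBelow-≡0 (suc m) F c≡0 {suc q} (s<s q<m) | false = countBelow-≡0 m (F ∘ suc) c≡0 q<m

bit≤countBelow : ∀ {m q} F → q < m → bit (F q) ≤ countBelow m F
bit≤countBelow {suc m} {zero}  F _         = m≤m+n _ _
bit≤countBelow {suc m} {suc q} F (s<s q<m) = ≤-trans (bit≤countBelow (F ∘ suc) q<m) (m≤n+m _ _)

countBelow-mono : ∀ m {F G} → (∀ q → T (F q) → T (G q)) → countBelow m F ≤ countBelow m G
countBelow-mono zero    F⇒G = z≤n
countBelow-mono (suc m) F⇒G = +-mono-≤ (bit-mono (F⇒G 0)) (countBelow-mono m (λ q → F⇒G (suc q)))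

countBelow-≤-suc : ∀ m F → countBelow m F ≤ countBelow (suc m) F
countBelow-≤-suc zero    F = z≤n
countBelow-≤-suc (suc m) F = +-monoʳ-≤ (bit (F 0)) (countBelow-≤-suc m (F ∘ suc))

countBelow-xor-≤ : ∀ m F G → countBelow m (λ q → F q xor G q) ≤ countBelow m F + countBelow m G
countBelow-xor-≤ zero    F G = z≤n
countBelow-xor-≤ (suc m) F G = begin
  bit (F 0 xor G 0) + countBelow m (λ q → F (suc q) xor G (suc q))
    ≤⟨ +-mono-≤ (bit-xor-≤ (F 0) (G 0)) (countBelow-xor-≤ m (F ∘ suc) (G ∘ suc)) ⟩
  (bit (F 0) + bit (G 0)) + (countBelow m (F ∘ suc) + countBelow m (G ∘ suc))
    ≡⟨ +-CS.interchange (bit (F 0)) (bit (G 0)) _ _ ⟩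
  countBelow (suc m) F + countBelow (suc m) G ∎
  where open ≤-Reasoning

countBelow-swap : ∀ m F G p → suc p < m → G p ≡ F (suc p) → G (suc p) ≡ F p →
                  (∀ q → q ≢ p → q ≢ suc p → G q ≡ F q) → countBelow m G ≡ countBelow m F
countBelow-swap (suc (suc m)) F G zero _ Gp Gsp rest
  rewrite Gp | Gsp
        | countBelow-cong m {G ∘ suc ∘ suc} {F ∘ suc ∘ suc} (λ {q} _ → rest (suc (suc q)) (λ ()) (λ ()))
  = +-CS.x∙yz≈y∙xz (bit (F 1)) (bit (F 0)) _
countBelow-swap (suc m) F G (suc p) (s<s p<m) Gp Gsp rest =
  cong₂ _+_ (cong bit (rest 0 (λ ()) (λ ())))
            (countBelow-swap m (F ∘ suc) (G ∘ suc) p p<m Gp Gsp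
              (λ q q≢p q≢sp → rest (suc q) (q≢p ∘ suc-injective) (q≢sp ∘ suc-injective)))

odd-countBelow-≤ : ∀ m i → countBelow m (λ q → isOdd q ∧ (q <ᵇ 2 * i)) ≤ i
odd-countBelow-≤ m zero =
  ≤-reflexive (trans (countBelow-cong m (λ {q} _ → ∧-zeroʳ (isOdd q))) (countBelow-false m))
odd-countBelow-≤ zero (suc i) = z≤n
odd-countBelow-≤ (suc zero) (suc i) = z≤n
odd-countBelow-≤ (suc (suc m)) (suc i) =
  subst (λ c → countBelow (2 + m) (λ q → isOdd q ∧ (q <ᵇ c)) ≤ suc i) (sym (*-suc 2 i))
        (s≤s (odd-countBelow-≤ m i))

-- Bit lists, prefix xors and adjacent transpositions

infixl 10 _!_
_!_ : List Bool → ℕ → Bool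
[]       ! q     = false
(x ∷ xs) ! zero  = x
(x ∷ xs) ! suc q = xs ! q

prefixXor : List Bool → ℕ → Bool
prefixXor xs q = xorBelow q (xs !_)

trues : List Bool → ℕ
trues xs = countBelow (length xs) (xs !_)

falses : List Bool → ℕ
falses []       = 0
falses (x ∷ xs) = if x then falses xs else suc (falses xs)

ones zeros : ℕ → List Bool
ones c  = replicate c true
zeros z = replicate z false

length-ones-zeros : ∀ c z → length (ones c ++ zeros z) ≡ c + z
length-ones-zeros c z = trans (length-++ (ones c)) (cong₂ _+_ (length-replicate c) (length-replicate z))

trues-ones-zeros : ∀ c z → trues (ones c ++ zeros z) ≡ c
trues-ones-zeros zero    zero    = refl
trues-ones-zeros zero    (suc z) = trues-ones-zeros zero z
trues-ones-zeros (suc c) z       = cong suc (trues-ones-zeros c z)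

zeros-ones-last : ∀ z c → (zeros z ++ ones (suc c)) ! (z + c) ≡ true
zeros-ones-last zero    zero    = refl
zeros-ones-last zero    (suc c) = zeros-ones-last zero c
zeros-ones-last (suc z) c       = zeros-ones-last z c

applyUpTo-! : ∀ G {k q} → q < k → applyUpTo G k ! q ≡ G q
applyUpTo-! G {suc k} {zero}  _         = refl
applyUpTo-! G {suc k} {suc q} (s<s q<k) = applyUpTo-! (G ∘ suc) q<k

prefixXor-suc : ∀ xs q → prefixXor xs (suc q) ≡ prefixXor xs q xor xs ! q
prefixXor-suc xs q = xorBelow-suc q (xs !_)

prefixXor-beyond : ∀ xs {q} → length xs ≤ q → prefixXor xs q ≡ prefixXor xs (length xs)
prefixXor-beyond []       {q}     _         = xorBelow-false q
prefixXor-beyond (x ∷ xs) {suc q} (s≤s l≤q) = cong (x xor_) (prefixXor-beyond xs l≤q)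

prefixXor-length : ∀ xs → prefixXor xs (length xs) ≡ isOdd (trues xs)
prefixXor-length []           = refl
prefixXor-length (true ∷ xs)  = trans (cong not (prefixXor-length xs)) (sym (isOdd-suc (trues xs)))
prefixXor-length (false ∷ xs) = prefixXor-length xs

prefixXor-applyUpTo : ∀ G {k q} → q ≤ k → prefixXor (applyUpTo G k) q ≡ xorBelow q G
prefixXor-applyUpTo G q≤k = xorBelow-cong _ (λ q'<q → applyUpTo-! G (<-≤-trans q'<q q≤k))

prefixXor-zeros : ∀ z q → prefixXor (zeros z) q ≡ false
prefixXor-zeros zero    q       = xorBelow-false q
prefixXor-zeros (suc z) zero    = refl
prefixXor-zeros (suc z) (suc q) = prefixXor-zeros z q

prefixXor-ones : ∀ c ys {q} → q ≤ c → prefixXor (ones c ++ ys) q ≡ isOdd q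
prefixXor-ones c       ys {zero}  _         = refl
prefixXor-ones (suc c) ys {suc q} (s≤s q≤c) =
  trans (cong not (prefixXor-ones c ys q≤c)) (sym (isOdd-suc q))

prefixXor-ones-++ : ∀ c ys q → prefixXor (ones c ++ ys) (c + q) ≡ isOdd c xor prefixXor ys q
prefixXor-ones-++ zero    ys q = refl
prefixXor-ones-++ (suc c) ys q =
  trans (cong not (prefixXor-ones-++ c ys q))
        (trans (not-distribˡ-xor (isOdd c) _) (cong (_xor prefixXor ys q) (sym (isOdd-suc c))))

prefixXor-even-ones-zeros : ∀ c z q → isOdd c ≡ false →
                            prefixXor (ones c ++ zeros z) q ≡ isOdd q ∧ (q <ᵇ c)
prefixXor-even-ones-zeros c z q even with q <? c
... | yes q<c rewrite <⇒<ᵇ-true q<c = trans (prefixXor-ones c (zeros z) (<⇒≤ q<c)) (sym (∧-identityʳ (isOdd q)))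
... | no  q≮c rewrite ≮⇒<ᵇ-false q≮c | ∧-zeroʳ (isOdd q) = begin
  prefixXor (ones c ++ zeros z) q             ≡⟨ cong (prefixXor (ones c ++ zeros z)) (m+[n∸m]≡n (≮⇒≥ q≮c)) ⟨
  prefixXor (ones c ++ zeros z) (c + (q ∸ c)) ≡⟨ prefixXor-ones-++ c (zeros z) (q ∸ c) ⟩
  isOdd c xor prefixXor (zeros z) (q ∸ c)     ≡⟨ cong₂ _xor_ even (prefixXor-zeros z (q ∸ c)) ⟩
  false                                       ∎
  where open ≡-Reasoning

data Swap : ℕ → List Bool → List Bool → Set where
  here  : ∀ {x y zs} → Swap 0 (x ∷ y ∷ zs) (y ∷ x ∷ zs)
  there : ∀ {p x xs ys} → Swap p xs ys → Swap (suc p) (x ∷ xs) (x ∷ ys)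

AdjacentSwap : List Bool → List Bool → Set
AdjacentSwap xs ys = ∃ λ p → Swap p xs ys

Swaps : List Bool → List Bool → Set
Swaps = Star AdjacentSwap

Swap-sym : ∀ {p xs ys} → Swap p xs ys → Swap p ys xs
Swap-sym here      = here
Swap-sym (there s) = there (Swap-sym s)

Swap-length : ∀ {p xs ys} → Swap p xs ys → length ys ≡ length xs
Swap-length here      = refl
Swap-length (there s) = cong suc (Swap-length s)

Swap-bound : ∀ {p xs ys} → Swap p xs ys → suc (suc p) ≤ length xs
Swap-bound here      = s≤s (s≤s z≤n)
Swap-bound (there s) = s≤s (Swap-bound s)

Swap-prefixXor : ∀ {p xs ys} → Swap p xs ys → ∀ {q} → q ≢ suc p → prefixXor ys q ≡ prefixXor xs q
Swap-prefixXor here                   {zero}        _  = refl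
Swap-prefixXor here                   {suc zero}    q≢ = contradiction refl q≢
Swap-prefixXor {xs = x ∷ y ∷ zs} here {suc (suc q)} _  = xor-left-comm y x _
Swap-prefixXor (there s)              {zero}        _  = refl
Swap-prefixXor {xs = x ∷ _} (there s) {suc q}       q≢ = cong (x xor_) (Swap-prefixXor s (q≢ ∘ cong suc))

Swap-prefixXor-middle : ∀ {p xs ys} → Swap p xs ys →
  prefixXor ys (suc p) ≡ prefixXor xs (suc p) xor (prefixXor xs (suc (suc p)) xor prefixXor xs p)
Swap-prefixXor-middle {xs = true  ∷ true  ∷ _} here = refl
Swap-prefixXor-middle {xs = true  ∷ false ∷ _} here = refl
Swap-prefixXor-middle {xs = false ∷ true  ∷ _} here = refl
Swap-prefixXor-middle {xs = false ∷ false ∷ _} here = refl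
Swap-prefixXor-middle {suc p} {x ∷ xs} (there s) =
  trans (cong (x xor_) (Swap-prefixXor-middle s)) (xor-thrice x _ _ _)
  where
  xor-thrice : ∀ x a b c → x xor (a xor (b xor c)) ≡ (x xor a) xor ((x xor b) xor (x xor c))
  xor-thrice = solve 4 (λ x a b c → x :+ (a :+ (b :+ c)) := (x :+ a) :+ ((x :+ b) :+ (x :+ c))) refl
    where open xor-∧-Solver

Swaps-∷ : ∀ x {xs ys} → Swaps xs ys → Swaps (x ∷ xs) (x ∷ ys)
Swaps-∷ x = Star.gmap (x ∷_) (λ { (p , s) → suc p , there s })

Swaps-sym : ∀ {xs ys} → Swaps xs ys → Swaps ys xs
Swaps-sym = reverse (λ { (p , s) → p , Swap-sym s })

bubble : ∀ c ys → Swaps (false ∷ ones c ++ ys) (ones c ++ false ∷ ys)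
bubble zero    ys = ε
bubble (suc c) ys = (0 , here) ◅ Swaps-∷ true (bubble c ys)

sortBySwaps : ∀ xs → Swaps xs (ones (trues xs) ++ zeros (falses xs))
sortBySwaps []           = ε
sortBySwaps (true ∷ xs)  = Swaps-∷ true (sortBySwaps xs)
sortBySwaps (false ∷ xs) = Swaps-∷ false (sortBySwaps xs) ◅◅ bubble (trues xs) (zeros (falses xs))

ones-zeros-Swaps : ∀ c z → Swaps (ones c ++ zeros z) (zeros z ++ ones c)
ones-zeros-Swaps c zero    = subst (Swaps (ones c ++ [])) (++-identityʳ (ones c)) ε
ones-zeros-Swaps c (suc z) = Swaps-sym (bubble c (zeros z)) ◅◅ Swaps-∷ false (ones-zeros-Swaps c z)

-- Labelings as sequences indexed by ℕ

infix 4 _≐_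
_≐_ : ∀ {m} → Labeling m → Labeling m → Set
b ≐ c = ∀ j → b j ≡ c j

restrict : ∀ {m} → (ℕ → Bool) → Labeling m
restrict F j = F (toℕ j)

asSeq : ∀ {m} → Labeling m → ℕ → Bool
asSeq {zero}  b _       = false
asSeq {suc m} b zero    = b Fin.zero
asSeq {suc m} b (suc q) = asSeq (b ∘ Fin.suc) q

restrict-asSeq : ∀ {m} (b : Labeling m) → restrict (asSeq b) ≐ b
restrict-asSeq b Fin.zero    = refl
restrict-asSeq b (Fin.suc j) = restrict-asSeq (b ∘ Fin.suc) j

asSeq-restrict : ∀ {m} F {q} → q < m → asSeq {m} (restrict F) q ≡ F q
asSeq-restrict {suc m} F {zero}  _         = refl
asSeq-restrict {suc m} F {suc q} (s<s q<m) = asSeq-restrict {m} (F ∘ suc) q<m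

asSeq-cong : ∀ {m} {b c : Labeling m} → b ≐ c → ∀ q → asSeq b q ≡ asSeq c q
asSeq-cong {zero}  b≐c q       = refl
asSeq-cong {suc m} b≐c zero    = b≐c Fin.zero
asSeq-cong {suc m} b≐c (suc q) = asSeq-cong (λ j → b≐c (Fin.suc j)) q

xorSum-cong : ∀ {m} {b c : Labeling m} → b ≐ c → xorSum b ≡ xorSum c
xorSum-cong {zero}  b≐c = refl
xorSum-cong {suc m} b≐c = cong₂ _xor_ (b≐c Fin.zero) (xorSum-cong (λ j → b≐c (Fin.suc j)))

xorSum-restrict : ∀ {m} F → xorSum {m} (restrict F) ≡ xorBelow m F
xorSum-restrict {zero}  F = refl
xorSum-restrict {suc m} F = cong (F 0 xor_) (xorSum-restrict {m} (F ∘ suc))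

weight-cong : ∀ {m} {b c : Labeling m} → b ≐ c → weight b ≡ weight c
weight-cong {zero}  b≐c = refl
weight-cong {suc m} b≐c = cong₂ (λ x y → bit x + y) (b≐c Fin.zero) (weight-cong (λ j → b≐c (Fin.suc j)))

weight-restrict : ∀ {m} F → weight {m} (restrict F) ≡ countBelow m F
weight-restrict {zero}  F = refl
weight-restrict {suc m} F = cong (bit (F 0) +_) (weight-restrict {m} (F ∘ suc))

weight≡countBelow : ∀ {m} (b : Labeling m) → weight b ≡ countBelow m (asSeq b)
weight≡countBelow {m} b = trans (sym (weight-cong (restrict-asSeq b))) (weight-restrict {m} (asSeq b))

⌊≟⌋≡≡ᵇ : ∀ {m} (j i : Fin m) → ⌊ j Fin.≟ i ⌋ ≡ (toℕ j ≡ᵇ toℕ i)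
⌊≟⌋≡≡ᵇ j i with j Fin.≟ i
... | yes refl = sym (≡ᵇ-refl (toℕ j))
... | no  j≢i  = sym (≢⇒≡ᵇ-false (j≢i ∘ toℕ-injective))

move-cong : ∀ {m} (G : PuzzleGraph m) i {b c} → b ≐ c → move G i b ≐ move G i c
move-cong G i b≐c j =
  cong₂ (if ⌊ j Fin.≟ i ⌋ then_else_)
        (cong₂ _xor_ (b≐c i)
                     (xorSum-cong (λ k → cong (λ x → adjacent G i k ∧ not (shorterAt G i k) ∧ x) (b≐c k))))
        (b≐c j)

-- Pointwise equal labelings are related by moving once at vertex 0 from each of them.
≐⇒Equiv : ∀ {m} (G : PuzzleGraph (suc m)) {b c} → b ≐ c → Equiv G b c
≐⇒Equiv G b≐c = fwd (Fin.zero , λ _ → refl) ◅ bwd (Fin.zero , move-cong G Fin.zero b≐c) ◅ ε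

module _ {k : ℕ} where

  toIndex : RepIx k → Fin (4 + k)
  toIndex single0  = Fin.zero
  toIndex singleN  = Fin.suc Fin.zero
  toIndex both     = Fin.suc (Fin.suc Fin.zero)
  toIndex (odds i) = Fin.suc (Fin.suc (Fin.suc i))

  fromIndex : Fin (4 + k) → RepIx k
  fromIndex Fin.zero                            = single0
  fromIndex (Fin.suc Fin.zero)                  = singleN
  fromIndex (Fin.suc (Fin.suc Fin.zero))        = both
  fromIndex (Fin.suc (Fin.suc (Fin.suc i)))     = odds i

  fromIndex-toIndex : ∀ r → fromIndex (toIndex r) ≡ r
  fromIndex-toIndex single0  = refl
  fromIndex-toIndex singleN  = refl
  fromIndex-toIndex both     = refl
  fromIndex-toIndex (odds i) = refl

  toIndex-fromIndex : ∀ i → toIndex (fromIndex i) ≡ i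
  toIndex-fromIndex Fin.zero                        = refl
  toIndex-fromIndex (Fin.suc Fin.zero)              = refl
  toIndex-fromIndex (Fin.suc (Fin.suc Fin.zero))    = refl
  toIndex-fromIndex (Fin.suc (Fin.suc (Fin.suc i))) = refl

  indexOf : RepIx k → Fin (k + 4)
  indexOf = cast (+-comm 4 k) ∘ toIndex

  repAt : Fin (k + 4) → RepIx k
  repAt = fromIndex ∘ cast (+-comm k 4)

  repAt-indexOf : ∀ r → repAt (indexOf r) ≡ r
  repAt-indexOf r = trans (cong fromIndex (cast-involutive (+-comm k 4) (+-comm 4 k) (toIndex r))) (fromIndex-toIndex r)

  indexOf-repAt : ∀ i → indexOf (repAt i) ≡ i
  indexOf-repAt i = trans (cong (cast (+-comm 4 k)) (toIndex-fromIndex _)) (cast-involutive (+-comm 4 k) (+-comm k 4) i)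

-- The graph Zₙ for n = n′ + 1

module Zₙ (n′ : ℕ) where

  n : ℕ
  n = suc n′

  interior : ℕ → Bool
  interior q = (0 <ᵇ q) ∧ (q <ᵇ n)

  inner : (ℕ → Bool) → ℕ → Bool
  inner F q = interior q ∧ F q

  -- At P = 0 the truncated P ∸ 1 is 0, which is not interior.
  neighbourSum : (ℕ → Bool) → ℕ → Bool
  neighbourSum F P = inner F (suc P) xor inner F (P ∸ 1)

  moveSeq : ℕ → (ℕ → Bool) → ℕ → Bool
  moveSeq P F q = if q ≡ᵇ P then F P xor neighbourSum F P else F q

  inner-beyond : ∀ F {q} → q ≮ n → inner F q ≡ false
  inner-beyond F {q} q≮n rewrite ≮⇒<ᵇ-false q≮n | ∧-zeroʳ (0 <ᵇ q) = refl

  inner-bounded : ∀ F a → (a <ᵇ suc n) ∧ inner F a ≡ inner F a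
  inner-bounded F a with a <? suc n
  ... | yes a<sn rewrite <⇒<ᵇ-true a<sn = refl
  ... | no  a≮sn rewrite ≮⇒<ᵇ-false a≮sn = sym (inner-beyond F (a≮sn ∘ m<n⇒m<1+n))

  -- A neighbour counts in the move at i exactly when it is interior: the shorter endpoints of the
  -- two double edges are 0 and n.
  counted-neighbour : ∀ (i k : Fin (suc n)) x →
    adjacent (Z n) i k ∧ not (shorterAt (Z n) i k) ∧ x
      ≡ ((suc (toℕ i) ≡ᵇ toℕ k) ∧ interior (toℕ k) ∧ x)
        xor ((suc (toℕ k) ≡ᵇ toℕ i) ∧ interior (toℕ k) ∧ x)
  counted-neighbour i k x rewrite +-comm (toℕ i) 1 | +-comm (toℕ k) 1
    with toℕ i | toℕ<n i | toℕ k | toℕ<n k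
  ... | P | s≤s P≤n | q | s≤s q≤n with suc P ≡ᵇ q in up | suc q ≡ᵇ P in down
  ... | true  | true  =
    contradiction (≤-reflexive (≡ᵇ-true⇒≡ {suc q} down)) (<-asym (≤-reflexive (≡ᵇ-true⇒≡ {suc P} up)))
  ... | true  | false with refl ← ≡ᵇ-true⇒≡ {suc P} {q} up =
    trans (cong (_∧ x) (not-shorter-above q≤n)) (sym (xor-identityʳ _))
    where
    not-shorter-above : P < n → not (((P ≡ᵇ 1) ∧ false) ∨ ((P ≡ᵇ n′) ∧ (P ≡ᵇ n′))) ≡ (P <ᵇ n′)
    not-shorter-above (s≤s P≤n′) rewrite ∧-zeroʳ (P ≡ᵇ 1) | ∧-idem (P ≡ᵇ n′) = ≤⇒not-≡ᵇ≡<ᵇ P≤n′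
  ... | false | true  with refl ← ≡ᵇ-true⇒≡ {suc q} {P} down = cong (_∧ x) (not-shorter-below q P≤n)
    where
    not-shorter-below : ∀ q → q < n →
      not (((suc q ≡ᵇ 1) ∧ (q ≡ᵇ 0)) ∨ ((suc q ≡ᵇ n′) ∧ (q ≡ᵇ n))) ≡ interior q
    not-shorter-below zero    _   = refl
    not-shorter-below (suc q) q<n rewrite ≢⇒≡ᵇ-false (<⇒≢ q<n) | ∧-zeroʳ (suc (suc q) ≡ᵇ n′) =
      sym (<⇒<ᵇ-true q<n)
  ... | false | false = refl

  xorSum-counted : ∀ (i : Fin (suc n)) F →
    xorSum (λ k → adjacent (Z n) i k ∧ not (shorterAt (Z n) i k) ∧ F (toℕ k)) ≡ neighbourSum F (toℕ i)
  xorSum-counted i F = begin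
    xorSum (λ k → adjacent (Z n) i k ∧ not (shorterAt (Z n) i k) ∧ F (toℕ k))
      ≡⟨ xorSum-cong (λ k → counted-neighbour i k (F (toℕ k))) ⟩
    xorSum (restrict {suc n} (λ q → right q xor left q))
      ≡⟨ xorSum-restrict {suc n} (λ q → right q xor left q) ⟩
    xorBelow (suc n) (λ q → right q xor left q)
      ≡⟨ xorBelow-xor (suc n) right left ⟩
    xorBelow (suc n) right xor xorBelow (suc n) left
      ≡⟨ cong₂ _xor_ (trans (xorBelow-pointˡ (suc n) (suc P) (inner F)) (inner-bounded F (suc P))) (sum-left P) ⟩
    neighbourSum F P ∎
    where
    open ≡-Reasoning
    P = toℕ i
    right left : ℕ → Bool
    right q = (suc P ≡ᵇ q) ∧ inner F q
    left  q = (suc q ≡ᵇ P) ∧ inner F q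
    sum-left : ∀ P → xorBelow (suc n) (λ q → (suc q ≡ᵇ P) ∧ inner F q) ≡ inner F (P ∸ 1)
    sum-left zero    = xorBelow-false (suc n)
    sum-left (suc p) = trans (xorBelow-pointʳ (suc n) p (inner F)) (inner-bounded F p)

  move-restrict : ∀ i F → move (Z n) i (restrict F) ≐ restrict (moveSeq (toℕ i) F)
  move-restrict i F j =
    cong₂ (λ c s → if c then F (toℕ i) xor s else F (toℕ j)) (⌊≟⌋≡≡ᵇ j i) (xorSum-counted i F)

  moveSeq-Equiv : ∀ {P} F G → P ≤ n → (∀ {q} → q ≤ n → moveSeq P F q ≡ G q) →
                  Equiv (Z n) (restrict F) (restrict G)
  moveSeq-Equiv {P} F G P≤n agree = fwd (i , λ j → sym (trans (move-restrict i F j) (agree′ j))) ◅ ε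
    where
    i = fromℕ< (s≤s P≤n)
    agree′ : ∀ j → moveSeq (toℕ i) F (toℕ j) ≡ G (toℕ j)
    agree′ j rewrite toℕ-fromℕ< (s≤s P≤n) = agree (≤-pred (toℕ<n j))

  jump : (ℕ → Bool) → ℕ → Bool
  jump F q = inner F q xor inner F (suc q)

  jumps : (ℕ → Bool) → ℕ
  jumps F = countBelow n (jump F)

  boundaryIfFlat : ℕ → Bool → Bool → Bool × Bool
  boundaryIfFlat zero    b₀ bₙ = b₀ , bₙ
  boundaryIfFlat (suc _) _  _  = false , false

  invariant : (ℕ → Bool) → ℕ × Bool × Bool
  invariant F = jumps F , boundaryIfFlat (jumps F) (F 0) (F n)

  inner-cong : ∀ {F G} → (∀ {q} → q ≤ n → F q ≡ G q) → ∀ q → inner F q ≡ inner G q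
  inner-cong {F} {G} F≗G q with q <? n
  ... | yes q<n = cong (interior q ∧_) (F≗G (<⇒≤ q<n))
  ... | no  q≮n = trans (inner-beyond F q≮n) (sym (inner-beyond G q≮n))

  invariant-cong : ∀ {F G} → (∀ {q} → q ≤ n → F q ≡ G q) → invariant F ≡ invariant G
  invariant-cong {F} {G} F≗G
    rewrite countBelow-cong n {jump F} {jump G} (λ {q} _ → cong₂ _xor_ (inner-cong F≗G q) (inner-cong F≗G (suc q)))
          | F≗G {0} z≤n | F≗G {n} ≤-refl = refl

  flat⇒inner-false : ∀ F → jumps F ≡ 0 → ∀ q → inner F q ≡ false
  flat⇒inner-false F flat q with q <? n
  ... | no  q≮n = inner-beyond F q≮n
  ... | yes q<n = begin
    inner F q                ≡⟨ xorBelow-telescope q (inner F) ⟨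
    xorBelow q (jump F)      ≡⟨ xorBelow-cong q (λ r<q → countBelow-≡0 n (jump F) flat (<-trans r<q q<n)) ⟩
    xorBelow q (λ _ → false) ≡⟨ xorBelow-false q ⟩
    false                    ∎
    where open ≡-Reasoning

  moveSeq-other : ∀ {P} F {q} → q ≢ P → moveSeq P F q ≡ F q
  moveSeq-other F q≢P rewrite ≢⇒≡ᵇ-false q≢P = refl

  moveSeq-noflip : ∀ F P → neighbourSum F P ≡ false → ∀ q → moveSeq P F q ≡ F q
  moveSeq-noflip F P noflip q with q ≟ P
  ... | yes refl rewrite ≡ᵇ-refl q | noflip = xor-identityʳ (F q)
  ... | no  q≢P  = moveSeq-other F q≢P

  flip-swaps-jumps : ∀ a b c → c xor a ≡ true → (a xor not b ≡ b xor c) × (not b xor c ≡ a xor b)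
  flip-swaps-jumps true  true  false _ = refl , refl
  flip-swaps-jumps true  false false _ = refl , refl
  flip-swaps-jumps false true  true  _ = refl , refl
  flip-swaps-jumps false false true  _ = refl , refl
  flip-swaps-jumps true  _     true  ()
  flip-swaps-jumps false _     false ()

  -- A move at an interior vertex P that changes the label swaps the jumps on the two edges at P.
  jumps-moveSeq : ∀ F P → neighbourSum F P ≡ true → jumps (moveSeq P F) ≡ jumps F
  jumps-moveSeq F P flip with interior P in intP
  ... | false = countBelow-cong n (λ {q} _ → cong₂ _xor_ (same q) (same (suc q)))
    where
    same : ∀ q → inner (moveSeq P F) q ≡ inner F q
    same q with q ≟ P
    ... | yes refl rewrite intP = refl
    ... | no  q≢P  = cong (interior q ∧_) (moveSeq-other F q≢P)
  jumps-moveSeq F zero    flip | true = contradiction intP λ ()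
  jumps-moveSeq F (suc p) flip | true =
    countBelow-swap n (jump F) (jump G) p sp<n (proj₁ swapped) (proj₂ swapped) rest
    where
    G = moveSeq (suc p) F
    sp<n : suc p < n
    sp<n = <ᵇ⇒< (suc p) n (≡true⇒T intP)
    inner-F : inner F (suc p) ≡ F (suc p)
    inner-F = cong (_∧ F (suc p)) intP
    inner-G : inner G (suc p) ≡ not (F (suc p))
    inner-G rewrite ≡ᵇ-refl p | intP | flip = xor-comm (F (suc p)) true
    other : ∀ {q} → q ≢ suc p → inner G q ≡ inner F q
    other {q} q≢ = cong (interior q ∧_) (moveSeq-other F q≢)
    swapped : (jump G p ≡ jump F (suc p)) × (jump G (suc p) ≡ jump F p)
    swapped with flip-swaps-jumps (inner F p) (F (suc p)) (inner F (suc (suc p))) flip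
    ... | e₁ , e₂ rewrite other {p} (λ ()) | other {suc (suc p)} (λ ()) | inner-G | inner-F = e₁ , e₂
    rest : ∀ q → q ≢ p → q ≢ suc p → jump G q ≡ jump F q
    rest q q≢p q≢sp = cong₂ _xor_ (other q≢sp) (other (q≢p ∘ suc-injective))

  flat⇒noflip : ∀ F P → jumps F ≡ 0 → neighbourSum F P ≡ false
  flat⇒noflip F P flat = cong₂ _xor_ (flat⇒inner-false F flat (suc P)) (flat⇒inner-false F flat (P ∸ 1))

  invariant-nonflat : ∀ F {c} → jumps F ≡ suc c → invariant F ≡ (suc c , false , false)
  invariant-nonflat F = cong (λ j → j , boundaryIfFlat j (F 0) (F n))

  invariant-moveSeq : ∀ P F → invariant (moveSeq P F) ≡ invariant F
  invariant-moveSeq P F = by-flip (neighbourSum F P) refl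
    where
    by-flip : ∀ x → neighbourSum F P ≡ x → invariant (moveSeq P F) ≡ invariant F
    by-flip false noflip = invariant-cong (λ {q} _ → moveSeq-noflip F P noflip q)
    by-flip true  flip   = by-jumps (jumps F) refl
      where
      by-jumps : ∀ c → jumps F ≡ c → invariant (moveSeq P F) ≡ invariant F
      by-jumps zero    flat = contradiction (trans (sym flip) (flat⇒noflip F P flat)) λ ()
      by-jumps (suc c) nonflat =
        trans (invariant-nonflat (moveSeq P F) (trans (jumps-moveSeq F P flip) nonflat))
              (sym (invariant-nonflat F nonflat))

  classInvariant : Labeling (suc n) → ℕ × Bool × Bool
  classInvariant b = invariant (asSeq b)

  step-invariant : ∀ {b c} → Step (Z n) b c → classInvariant b ≡ classInvariant c
  step-invariant {b} {c} (i , c≐move) = sym (begin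
    invariant (asSeq c)               ≡⟨ invariant-cong {asSeq c} {moveSeq (toℕ i) F} agree ⟩
    invariant (moveSeq (toℕ i) F)     ≡⟨ invariant-moveSeq (toℕ i) F ⟩
    invariant F                       ∎)
    where
    open ≡-Reasoning
    F = asSeq b
    c≐ : c ≐ restrict (moveSeq (toℕ i) F)
    c≐ j = trans (c≐move j) (trans (move-cong (Z n) i (λ j′ → sym (restrict-asSeq b j′)) j) (move-restrict i F j))
    agree : ∀ {q} → q ≤ n → asSeq c q ≡ moveSeq (toℕ i) F q
    agree {q} q≤n = trans (asSeq-cong c≐ q) (asSeq-restrict (moveSeq (toℕ i) F) (s≤s q≤n))

  Equiv-invariant : ∀ {b c} → Equiv (Z n) b c → classInvariant b ≡ classInvariant c
  Equiv-invariant = Closure.gfold isEquivalence classInvariant step-invariant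

  -- The labeling with boundary labels b₀, bₙ whose interior part has jump sequence xs.
  lab : Bool → Bool → List Bool → ℕ → Bool
  lab b₀ bₙ xs q = if q ≡ᵇ 0 then b₀ else if q ≡ᵇ n then bₙ else prefixXor xs q

  lab-at-n : ∀ b₀ bₙ xs → lab b₀ bₙ xs n ≡ bₙ
  lab-at-n b₀ bₙ xs rewrite ≡ᵇ-refl n = refl

  record IsJumpList (xs : List Bool) : Set where
    constructor _,_
    field
      length≡n : length xs ≡ n
      closes   : prefixXor xs n ≡ false
  open IsJumpList

  IsJumpList⇒even : ∀ {xs} → IsJumpList xs → isOdd (trues xs) ≡ false
  IsJumpList⇒even {xs} (len , par) =
    trans (sym (prefixXor-length xs)) (subst (λ l → prefixXor xs l ≡ false) (sym len) par)

  Swap-IsJumpList : ∀ {p xs ys} → IsJumpList xs → Swap p xs ys → IsJumpList ys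
  Swap-IsJumpList (len , par) s =
    trans (Swap-length s) len ,
    trans (Swap-prefixXor s λ n≡sp → <-irrefl (sym n≡sp) (subst (_ ≤_) len (Swap-bound s))) par

  Swaps-IsJumpList : ∀ {xs ys} → IsJumpList xs → Swaps xs ys → IsJumpList ys
  Swaps-IsJumpList jl ε              = jl
  Swaps-IsJumpList jl ((_ , s) ◅ ss) = Swaps-IsJumpList (Swap-IsJumpList jl s) ss

  inner-lab : ∀ b₀ bₙ {xs} → IsJumpList xs → ∀ q → inner (lab b₀ bₙ xs) q ≡ prefixXor xs q
  inner-lab _  _            _           zero    = refl
  inner-lab b₀ bₙ {xs} (len , par) (suc q) with suc q <? n
  ... | yes sq<n rewrite <⇒<ᵇ-true sq<n | ≢⇒≡ᵇ-false (<⇒≢ sq<n) = refl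
  ... | no  sq≮n = begin
    inner (lab b₀ bₙ xs) (suc q) ≡⟨ inner-beyond (lab b₀ bₙ xs) sq≮n ⟩
    false                        ≡⟨ par ⟨
    prefixXor xs n               ≡⟨ cong (prefixXor xs) len ⟨
    prefixXor xs (length xs)     ≡⟨ prefixXor-beyond xs (subst (_≤ suc q) (sym len) (≮⇒≥ sq≮n)) ⟨
    prefixXor xs (suc q)         ∎
    where open ≡-Reasoning

  jump-lab : ∀ b₀ bₙ {xs} → IsJumpList xs → ∀ q → jump (lab b₀ bₙ xs) q ≡ xs ! q
  jump-lab b₀ bₙ {xs} jl q =
    trans (cong₂ _xor_ (inner-lab b₀ bₙ jl q) (trans (inner-lab b₀ bₙ jl (suc q)) (prefixXor-suc xs q)))
          (xor-cancelˡ (prefixXor xs q) (xs ! q))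

  invariant-lab : ∀ {b₀ bₙ xs} → IsJumpList xs →
                  invariant (lab b₀ bₙ xs) ≡ (trues xs , boundaryIfFlat (trues xs) b₀ bₙ)
  invariant-lab {b₀} {bₙ} {xs} jl =
    cong₂ (λ c bₙ′ → c , boundaryIfFlat c b₀ bₙ′) jumps≡trues (lab-at-n b₀ bₙ xs)
    where
    jumps≡trues : jumps (lab b₀ bₙ xs) ≡ trues xs
    jumps≡trues = trans (countBelow-cong n (λ {q} _ → jump-lab b₀ bₙ jl q))
                        (cong (λ l → countBelow l (xs !_)) (sym (length≡n jl)))

  jumpList : (ℕ → Bool) → List Bool
  jumpList F = applyUpTo (jump F) n

  prefixXor-jumpList : ∀ F {q} → q ≤ n → prefixXor (jumpList F) q ≡ inner F q
  prefixXor-jumpList F q≤n = trans (prefixXor-applyUpTo (jump F) q≤n) (xorBelow-telescope _ (inner F))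

  jumpList-IsJumpList : ∀ F → IsJumpList (jumpList F)
  jumpList-IsJumpList F =
    length-applyUpTo (jump F) n , trans (prefixXor-jumpList F ≤-refl) (inner-beyond F (<-irrefl refl))

  lab-jumpList : ∀ F {q} → q ≤ n → F q ≡ lab (F 0) (F n) (jumpList F) q
  lab-jumpList F {zero}  _     = refl
  lab-jumpList F {suc q} sq≤n with suc q ≡ᵇ n in sq≡n
  ... | true  = cong F (≡ᵇ-true⇒≡ {suc q} sq≡n)
  ... | false = sym (trans (prefixXor-jumpList F sq≤n) (cong (_∧ F (suc q)) (<⇒<ᵇ-true sq<n)))
    where
    sq<n : suc q < n
    sq<n = ≤∧≢⇒< sq≤n λ sq≡n′ → contradiction (trans (sym sq≡n) (T⇒≡true (≡⇒≡ᵇ (suc q) n sq≡n′))) λ ()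

  Swap-Equiv : ∀ {b₀ bₙ p xs ys} → IsJumpList xs → Swap p xs ys →
               Equiv (Z n) (restrict (lab b₀ bₙ xs)) (restrict (lab b₀ bₙ ys))
  Swap-Equiv {b₀} {bₙ} {p} {xs} {ys} jl s = moveSeq-Equiv (lab b₀ bₙ xs) (lab b₀ bₙ ys) (<⇒≤ sp<n) agree
    where
    sp<n : suc p < n
    sp<n = subst (suc (suc p) ≤_) (length≡n jl) (Swap-bound s)
    agree : ∀ {q} → q ≤ n → moveSeq (suc p) (lab b₀ bₙ xs) q ≡ lab b₀ bₙ ys q
    agree {q} _ with q ≟ suc p
    ... | yes refl rewrite ≡ᵇ-refl p | ≢⇒≡ᵇ-false (<⇒≢ sp<n)
                         | inner-lab b₀ bₙ jl (suc q) | inner-lab b₀ bₙ jl p =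
      sym (Swap-prefixXor-middle s)
    ... | no  q≢sp rewrite ≢⇒≡ᵇ-false q≢sp =
      cong (λ x → if q ≡ᵇ 0 then b₀ else if q ≡ᵇ n then bₙ else x) (sym (Swap-prefixXor s q≢sp))

  Swaps-Equiv : ∀ {b₀ bₙ xs ys} → IsJumpList xs → Swaps xs ys →
                Equiv (Z n) (restrict (lab b₀ bₙ xs)) (restrict (lab b₀ bₙ ys))
  Swaps-Equiv jl ε              = ε
  Swaps-Equiv jl ((_ , s) ◅ ss) = Swap-Equiv jl s ◅◅ Swaps-Equiv (Swap-IsJumpList jl s) ss

  clear-first : ∀ {b₀ bₙ xs} → IsJumpList (true ∷ xs) →
                Equiv (Z n) (restrict (lab b₀ bₙ (true ∷ xs))) (restrict (lab false bₙ (true ∷ xs)))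
  clear-first {false}          jl = ε
  clear-first {true} {bₙ} {xs} jl = moveSeq-Equiv (lab true bₙ (true ∷ xs)) (lab false bₙ (true ∷ xs)) z≤n agree
    where
    agree : ∀ {q} → q ≤ n → moveSeq 0 (lab true bₙ (true ∷ xs)) q ≡ lab false bₙ (true ∷ xs) q
    agree {zero}  _ rewrite inner-lab true bₙ jl 1 = refl
    agree {suc q} _ = refl

  moveSeq-at : ∀ P F → moveSeq P F P ≡ F P xor neighbourSum F P
  moveSeq-at P F rewrite ≡ᵇ-refl P = refl

  clear-last : ∀ {b₀ bₙ xs} → IsJumpList xs → xs ! n′ ≡ true →
               Equiv (Z n) (restrict (lab b₀ bₙ xs)) (restrict (lab b₀ false xs))
  clear-last {bₙ = false}       jl last = ε
  clear-last {b₀} {true} {xs} jl last = moveSeq-Equiv (lab b₀ true xs) (lab b₀ false xs) ≤-refl agree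
    where
    open ≡-Reasoning
    xor-true≡false : ∀ {a} → a xor true ≡ false → a ≡ true
    xor-true≡false {true} _ = refl
    before-last : prefixXor xs n′ ≡ true
    before-last = xor-true≡false (begin
      prefixXor xs n′ xor true      ≡⟨ cong (prefixXor xs n′ xor_) last ⟨
      prefixXor xs n′ xor xs ! n′   ≡⟨ prefixXor-suc xs n′ ⟨
      prefixXor xs n                ≡⟨ closes jl ⟩
      false                         ∎)
    beyond : prefixXor xs (suc n) ≡ false
    beyond = begin
      prefixXor xs (suc n)          ≡⟨ prefixXor-beyond xs (subst (_≤ suc n) (sym (length≡n jl)) (n≤1+n n)) ⟩
      prefixXor xs (length xs)      ≡⟨ cong (prefixXor xs) (length≡n jl) ⟩
      prefixXor xs n                ≡⟨ closes jl ⟩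
      false                         ∎
    agree : ∀ {q} → q ≤ n → moveSeq n (lab b₀ true xs) q ≡ lab b₀ false xs q
    agree {q} _ with q ≟ n
    ... | no  q≢n  rewrite ≢⇒≡ᵇ-false q≢n = refl
    ... | yes refl = begin
      moveSeq n (lab b₀ true xs) n
        ≡⟨ moveSeq-at n (lab b₀ true xs) ⟩
      lab b₀ true xs n xor (inner (lab b₀ true xs) (suc n) xor inner (lab b₀ true xs) n′)
        ≡⟨ cong₂ _xor_ (lab-at-n b₀ true xs)
                       (cong₂ _xor_ (trans (inner-lab b₀ true jl (suc n)) beyond)
                                    (trans (inner-lab b₀ true jl n′) before-last)) ⟩
      false
        ≡⟨ lab-at-n b₀ false xs ⟨
      lab b₀ false xs n ∎

  flatRep : Bool → Bool → RepIx (K n)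
  flatRep true  false = single0
  flatRep false true  = singleN
  flatRep true  true  = both
  flatRep false false = odds Fin.zero

  rep-odds : ∀ I z → rep n (odds I) ≐ restrict (lab false false (ones (2 * toℕ I) ++ zeros z))
  rep-odds I z j with toℕ j ≡ᵇ 0 | toℕ j ≡ᵇ n
  ... | true  | _     = refl
  ... | false | true  = refl
  ... | false | false = sym (prefixXor-even-ones-zeros (2 * toℕ I) z (toℕ j) (isOdd-2* (toℕ I)))

  rep-flatRep : ∀ b₀ bₙ z → rep n (flatRep b₀ bₙ) ≐ restrict (lab b₀ bₙ (zeros z))
  rep-flatRep false false z = rep-odds Fin.zero z
  rep-flatRep true  false z j = by-vertex (toℕ j) 
    where
    by-vertex : ∀ q → (q ≡ᵇ 0) ≡ lab true false (zeros z) q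
    by-vertex zero = refl
    by-vertex (suc q) with suc q ≡ᵇ n
    ... | true  = refl
    ... | false = sym (prefixXor-zeros z (suc q))
  rep-flatRep false true  z j = by-vertex (toℕ j)
    where
    by-vertex : ∀ q → (q ≡ᵇ n) ≡ lab false true (zeros z) q
    by-vertex zero = refl
    by-vertex (suc q) with suc q ≡ᵇ n
    ... | true  = refl
    ... | false = sym (prefixXor-zeros z (suc q))
  rep-flatRep true  true  z j = by-vertex (toℕ j)
    where
    by-vertex : ∀ q → ((q ≡ᵇ 0) ∨ (q ≡ᵇ n)) ≡ lab true true (zeros z) q
    by-vertex zero = refl
    by-vertex (suc q) with suc q ≡ᵇ n
    ... | true  = refl
    ... | false = sym (prefixXor-zeros z (suc q))

  repInvariant : RepIx (K n) → ℕ × Bool × Bool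
  repInvariant single0  = 0 , true  , false
  repInvariant singleN  = 0 , false , true
  repInvariant both     = 0 , true  , true
  repInvariant (odds i) = 2 * toℕ i , false , false

  classInvariant-lab : ∀ {b b₀ bₙ xs} → IsJumpList xs → b ≐ restrict (lab b₀ bₙ xs) →
                       classInvariant b ≡ (trues xs , boundaryIfFlat (trues xs) b₀ bₙ)
  classInvariant-lab {b} {b₀} {bₙ} {xs} jl b≐ = trans (invariant-cong agree) (invariant-lab jl)
    where
    agree : ∀ {q} → q ≤ n → asSeq b q ≡ lab b₀ bₙ xs q
    agree {q} q≤n = trans (asSeq-cong b≐ q) (asSeq-restrict (lab b₀ bₙ xs) (s≤s q≤n))

  zeros-IsJumpList : IsJumpList (zeros n)
  zeros-IsJumpList = length-replicate n , prefixXor-zeros n n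

  2*≤n : ∀ (i : Fin (suc (K n))) → 2 * toℕ i ≤ n
  2*≤n i = begin
    2 * toℕ i         ≤⟨ *-monoʳ-≤ 2 (≤-pred (toℕ<n i)) ⟩
    2 * ⌊ n /2⌋       ≡⟨ cong (⌊ n /2⌋ +_) (+-identityʳ ⌊ n /2⌋) ⟩
    ⌊ n /2⌋ + ⌊ n /2⌋ ≤⟨ +-monoʳ-≤ ⌊ n /2⌋ (⌊n/2⌋≤⌈n/2⌉ n) ⟩
    ⌊ n /2⌋ + ⌈ n /2⌉ ≡⟨ ⌊n/2⌋+⌈n/2⌉≡n n ⟩
    n                 ∎
    where open ≤-Reasoning

  odds-IsJumpList : ∀ i → IsJumpList (ones (2 * toℕ i) ++ zeros (n ∸ 2 * toℕ i))
  odds-IsJumpList i = len , trans (cong (prefixXor xs) (sym len)) (trans (prefixXor-length xs) even)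
    where
    xs = ones (2 * toℕ i) ++ zeros (n ∸ 2 * toℕ i)
    len : length xs ≡ n
    len = trans (length-ones-zeros (2 * toℕ i) _) (m+[n∸m]≡n (2*≤n i))
    even : isOdd (trues xs) ≡ false
    even = trans (cong isOdd (trues-ones-zeros (2 * toℕ i) _)) (isOdd-2* (toℕ i))

  flat-invariant : ∀ b₀ bₙ → classInvariant (rep n (flatRep b₀ bₙ)) ≡ (0 , b₀ , bₙ)
  flat-invariant b₀ bₙ = trans (classInvariant-lab zeros-IsJumpList (rep-flatRep b₀ bₙ n))
                               (cong (λ c → c , boundaryIfFlat c b₀ bₙ) (trues-ones-zeros 0 n))

  boundaryIfFlat-false : ∀ c → boundaryIfFlat c false false ≡ (false , false)
  boundaryIfFlat-false zero    = refl
  boundaryIfFlat-false (suc _) = refl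

  invariant-rep : ∀ r → classInvariant (rep n r) ≡ repInvariant r
  invariant-rep single0  = flat-invariant true false
  invariant-rep singleN  = flat-invariant false true
  invariant-rep both     = flat-invariant true true
  invariant-rep (odds i) = trans (classInvariant-lab (odds-IsJumpList i) (rep-odds i _))
                                 (cong₂ _,_ (trues-ones-zeros (2 * toℕ i) _) (boundaryIfFlat-false _))

  repInvariant-injective : ∀ r s → repInvariant r ≡ repInvariant s → r ≡ s
  repInvariant-injective single0  single0  _ = refl
  repInvariant-injective singleN  singleN  _ = refl
  repInvariant-injective both     both     _ = refl
  repInvariant-injective (odds i) (odds j) e =
    cong odds (toℕ-injective (*-cancelˡ-≡ (toℕ i) (toℕ j) 2 (cong proj₁ e)))
  repInvariant-injective single0  singleN  ()
  repInvariant-injective single0  both     ()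
  repInvariant-injective single0  (odds _) ()
  repInvariant-injective singleN  single0  ()
  repInvariant-injective singleN  both     ()
  repInvariant-injective singleN  (odds _) ()
  repInvariant-injective both     single0  ()
  repInvariant-injective both     singleN  ()
  repInvariant-injective both     (odds _) ()
  repInvariant-injective (odds _) single0  ()
  repInvariant-injective (odds _) singleN  ()
  repInvariant-injective (odds _) both     ()

  rep-distinct : ∀ r s → Equiv (Z n) (rep n r) (rep n s) → r ≡ s
  rep-distinct r s e =
    repInvariant-injective r s (trans (sym (invariant-rep r)) (trans (Equiv-invariant e) (invariant-rep s)))

  classify-sorted : ∀ b₀ bₙ c z → isOdd c ≡ false → IsJumpList (ones c ++ zeros z) →
                    ∃ λ r → Equiv (Z n) (rep n r) (restrict (lab b₀ bₙ (ones c ++ zeros z)))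
  classify-sorted b₀ bₙ c z even jl with even⇒2* c even
  ... | zero  , refl = flatRep b₀ bₙ , ≐⇒Equiv (Z n) (rep-flatRep b₀ bₙ z)
  ... | suc i , refl = odds I , (begin
    rep n (odds I)                ≈⟨ ≐⇒Equiv (Z n) rep≐ ⟩
    restrict (lab false false S₁) ≈⟨ clear-first jl ⟨
    restrict (lab b₀ false S₁)    ≈⟨ Swaps-Equiv jl (ones-zeros-Swaps c z) ⟩
    restrict (lab b₀ false S₂)    ≈⟨ clear-last jl₂ last ⟨
    restrict (lab b₀ bₙ S₂)       ≈⟨ Swaps-Equiv jl₂ (Swaps-sym (ones-zeros-Swaps c z)) ⟩
    restrict (lab b₀ bₙ S₁)       ∎)
    where
    open SetoidReasoning (Closure.setoid (Step (Z n)))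
    c′ = i + suc (i + 0)  -- 2 * suc i reduces to suc c′
    S₁ = ones c ++ zeros z
    S₂ = zeros z ++ ones c
    jl₂ : IsJumpList S₂
    jl₂ = Swaps-IsJumpList jl (ones-zeros-Swaps c z)
    c+z≡n : c + z ≡ n
    c+z≡n = trans (sym (length-ones-zeros c z)) (length≡n jl)
    last : S₂ ! n′ ≡ true
    last = subst (λ k → S₂ ! k ≡ true) (trans (+-comm z c′) (suc-injective c+z≡n)) (zeros-ones-last z c′)
    i<sK : suc i < suc (K n)
    i<sK = s≤s (2*≤⇒≤⌊/2⌋ (suc i) n (subst (c ≤_) c+z≡n (m≤m+n c z)))
    I : Fin (suc (K n))
    I = fromℕ< i<sK
    rep≐ : rep n (odds I) ≐ restrict (lab false false S₁)
    rep≐ = subst (λ t → rep n (odds I) ≐ restrict (lab false false (ones (2 * t) ++ zeros z)))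
                 (toℕ-fromℕ< i<sK) (rep-odds I z)

  classify : ∀ b → ∃ λ r → Equiv (Z n) (rep n r) b
  classify b = proj₁ sorted , (begin
    rep n (proj₁ sorted)                       ≈⟨ proj₂ sorted ⟩
    restrict (lab (F 0) (F n) (ones c ++ zeros z)) ≈⟨ Swaps-Equiv jl (sortBySwaps xs) ⟨
    restrict (lab (F 0) (F n) xs)              ≈⟨ ≐⇒Equiv (Z n) b≐ ⟨
    b                                          ∎)
    where
    open SetoidReasoning (Closure.setoid (Step (Z n)))
    F = asSeq b
    xs = jumpList F
    c = trues xs
    z = falses xs
    jl = jumpList-IsJumpList F
    sorted = classify-sorted (F 0) (F n) c z (IsJumpList⇒even jl) (Swaps-IsJumpList jl (sortBySwaps xs))
    b≐ : b ≐ restrict (lab (F 0) (F n) xs)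
    b≐ j = trans (sym (restrict-asSeq b j)) (lab-jumpList F (≤-pred (toℕ<n j)))

  jumps-≤ : ∀ F → jumps F ≤ 2 * countBelow (suc n) F
  jumps-≤ F = begin
    jumps F
      ≤⟨ countBelow-xor-≤ n (inner F) (inner F ∘ suc) ⟩
    countBelow n (inner F) + countBelow n (inner F ∘ suc)
      ≤⟨ +-mono-≤ (countBelow-≤-suc n (inner F)) (m≤n+m _ (bit (inner F 0))) ⟩
    countBelow (suc n) (inner F) + countBelow (suc n) (inner F)
      ≤⟨ +-mono-≤ inner≤F inner≤F ⟩
    countBelow (suc n) F + countBelow (suc n) F
      ≡⟨ cong (countBelow (suc n) F +_) (+-identityʳ _) ⟨
    2 * countBelow (suc n) F ∎
    where
    open ≤-Reasoning
    inner≤F : countBelow (suc n) (inner F) ≤ countBelow (suc n) F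
    inner≤F = countBelow-mono (suc n) {inner F} {F} (λ q → T-∧-elimʳ (interior q))

  boundary-weight-≤ : ∀ F → bit (F 0) + bit (F n) ≤ countBelow (suc n) F
  boundary-weight-≤ F = +-monoʳ-≤ (bit (F 0)) (bit≤countBelow (F ∘ suc) ≤-refl)

  flat-boundary : ∀ F {b₀ bₙ} → invariant F ≡ (0 , b₀ , bₙ) → F 0 ≡ b₀ × F n ≡ bₙ
  flat-boundary F = helper (jumps F)
    where
    helper : ∀ c {b₀ bₙ} → (c , boundaryIfFlat c (F 0) (F n)) ≡ (0 , b₀ , bₙ) → F 0 ≡ b₀ × F n ≡ bₙ
    helper zero refl = refl , refl

  weight-single0 : weight (rep n single0) ≡ 1
  weight-single0 = trans (weight-restrict {suc n} (λ q → q ≡ᵇ 0)) (countBelow-point (suc n) 0 z<s)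

  weight-singleN : weight (rep n singleN) ≡ 1
  weight-singleN = trans (weight-restrict {suc n} (λ q → q ≡ᵇ n)) (countBelow-point (suc n) n ≤-refl)

  weight-both : weight (rep n both) ≡ 2
  weight-both =
    trans (weight-restrict {suc n} (λ q → (q ≡ᵇ 0) ∨ (q ≡ᵇ n))) (cong suc (countBelow-point n n′ ≤-refl))

  weight-odds-≤ : ∀ i → weight (rep n (odds i)) ≤ toℕ i
  weight-odds-≤ i = begin
    weight (rep n (odds i))
      ≡⟨ weight-restrict {suc n} oddsSeq ⟩
    countBelow (suc n) oddsSeq
      ≤⟨ countBelow-mono (suc n) {oddsSeq} (λ q → T-∧-elimʳ (not (q ≡ᵇ n)) ∘ T-∧-elimʳ (not (q ≡ᵇ 0))) ⟩
    countBelow (suc n) (λ q → isOdd q ∧ (q <ᵇ 2 * toℕ i))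
      ≤⟨ odd-countBelow-≤ (suc n) (toℕ i) ⟩
    toℕ i ∎
    where
    open ≤-Reasoning
    oddsSeq : ℕ → Bool
    oddsSeq q = not (q ≡ᵇ 0) ∧ not (q ≡ᵇ n) ∧ isOdd q ∧ (q <ᵇ 2 * toℕ i)

  rep-minimal : ∀ r b → Equiv (Z n) (rep n r) b → weight (rep n r) ≤ weight b
  rep-minimal r b e = subst (weight (rep n r) ≤_) (sym (weight≡countBelow b))
                            (bound r (trans (sym (invariant-rep r)) (Equiv-invariant e)))
    where
    F = asSeq b
    flat-bound : ∀ r b₀ bₙ → weight (rep n r) ≡ bit b₀ + bit bₙ → F 0 ≡ b₀ × F n ≡ bₙ →
                 weight (rep n r) ≤ countBelow (suc n) F
    flat-bound r _ _ w≡ (refl , refl) = ≤-trans (≤-reflexive w≡) (boundary-weight-≤ F)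
    bound : ∀ r → repInvariant r ≡ invariant F → weight (rep n r) ≤ countBelow (suc n) F
    bound single0  inv = flat-bound single0 true  false weight-single0 (flat-boundary F (sym inv))
    bound singleN  inv = flat-bound singleN false true  weight-singleN (flat-boundary F (sym inv))
    bound both     inv = flat-bound both    true  true  weight-both    (flat-boundary F (sym inv))
    bound (odds i) inv = ≤-trans (weight-odds-≤ i)
      (*-cancelˡ-≤ 2 (subst (_≤ 2 * countBelow (suc n) F) (sym (cong proj₁ inv)) (jumps-≤ F)))

open Zₙ using (classify; rep-distinct; rep-minimal)

proposition2p58 : (n : ℕ) → 2 ≤ n →
    ((b : Labeling (suc n)) → ∃ λ r → Equiv (Z n) (rep n r) b)
    × ((r s : RepIx (K n)) → Equiv (Z n) (rep n r) (rep n s) → r ≡ s)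
    × ((r : RepIx (K n)) (b : Labeling (suc n)) →
         Equiv (Z n) (rep n r) b → weight (rep n r) ≤ weight b)
    × (Σ (Fin (K n + 4) → Labeling (suc n)) λ f →
         ((b : Labeling (suc n)) → ∃ λ i → Equiv (Z n) (f i) b)
         × ((i j : Fin (K n + 4)) → Equiv (Z n) (f i) (f j) → i ≡ j))
-- The hypothesis 2 ≤ n only serves to exclude n = 0.
proposition2p58 (suc n′) _ =
  classify n′ , rep-distinct n′ , rep-minimal n′ , rep (suc n′) ∘ repAt , covers , injective
  where
  open Zₙ n′ using (n)
  covers : ∀ b → ∃ λ i → Equiv (Z n) (rep n (repAt i)) b
  covers b = indexOf r , subst (λ s → Equiv (Z n) (rep n s) b) (sym (repAt-indexOf r)) (proj₂ (classify n′ b))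
    where r = proj₁ (classify n′ b)
  injective : ∀ i j → Equiv (Z n) (rep n (repAt i)) (rep n (repAt j)) → i ≡ j
  injective i j e = trans (sym (indexOf-repAt i)) (trans (cong indexOf (rep-distinct n′ _ _ e)) (indexOf-repAt j))
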